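{- Let $D_0$ be a diagram with $(r,c)\in D_0$, and let $D_1,D_2\in\mathrm{KD}(D_0)$ with $D_2\preceq D_1$. For $i=1,2$ let $(r_i,c)$ be the standard $r$-cell in column $c$ of $D_i$ (relative to $D_0$). Then \[\mathrm{room}_{D_2}(r_2,c)\le\mathrm{room}_{D_1}(r_1,c).\]
   Context: A diagram is a finite subset $D\subset\mathbb{Z}_{>0}\times\mathbb{Z}_{>0}$; $(r,c)\in D$ is a cell in row $r$, column $c$. Kohnert move at row $r$: if row $r$ is empty, $\mathcal{K}(D,r)=D$; otherwise let $(r,c)$ be the rightmost cell of row $r$; if some $r'<r$ has $(r',c)\notin D$, take the largest such $r'$ and set $\mathcal{K}(D,r)=(D\setminus\{(r,c)\})\cup\{(r',c)\}$; else $\mathcal{K}(D,r)=D$. $\mathrm{KD}(D_0)$ is the set of diagrams obtainable from $D_0$ by finite sequences of Kohnert moves, partially ordered by $D_2\preceq D_1$ iff $D_2$ is obtainable from $D_1$ by a sequence of Kohnert moves. Kohnert moves preserve the number of cells in each column. For $D\in\mathrm{KD}(D_0)$ and $(r,c)\in D_0$, if $(r,c)$ is the $k$-th lowest cell of column $c$ in $D_0$, the standard $r$-cell in column $c$ of $D$ is the $k$-th lowest cell of column $c$ in $D$ (equivalently, the cell labeled $r$ in the unique labeling of $D$ that is strictly increasing up each column and uses in each column the same set of labels as the labeling $(r',c')\mapsto r'$ of $D_0$). For a diagram $D$, $(r,c)\in D$, $\tilde c>0$: $\mathrm{blockers}_{D,\tilde c}(r,c)=\{(\tilde r,\tilde c)\in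 D:\tilde r\le r\}$ and $\mathrm{room}_D(r,c)=r-\max_{\tilde c\ge c}|\mathrm{blockers}_{D,\tilde c}(r,c)|$. -}

module Defs where

open import Data.Nat using (ℕ; zero; suc; _≤_; _<_; _≤?_; _⊔_; _∸_; _≟_)
open import Data.Product using (Σ; _×_; _,_; proj₂)
open import Data.Product.Properties using (≡-dec)
open import Data.Sum using (_⊎_)
open import Data.List using (List; length; filter; map; foldr; upTo)
open import Data.List.Membership.Propositional using (_∈_; _∉_)
open import Data.List.Membership.DecPropositional (≡-dec _≟_ _≟_) using (_∈?_)
open import Relation.Binary.PropositionalEquality using (_≡_; _≢_)
open import Relation.Binary.Construct.Closure.ReflexiveTransitive using (Star)

-- A cell (r , c): row r, column c.
Cell : Set
Cell = ℕ × ℕ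

-- A diagram: a finite set of cells, represented by a list read as a set
-- (only membership matters; duplicates/order are irrelevant).
Diagram : Set
Diagram = List Cell

WellFormed : Diagram → Set
WellFormed D = ∀ r c → (r , c) ∈ D → (1 ≤ r × 1 ≤ c)

_≈D_ : Diagram → Diagram → Set
D ≈D D' = ∀ x → ((x ∈ D → x ∈ D') × (x ∈ D' → x ∈ D))

-- KMove D r D' : D' is (as a set) the Kohnert move K(D , r).
data KMove (D : Diagram) (r : ℕ) (D' : Diagram) : Set where
  rowEmpty : (∀ c → (r , c) ∉ D) → D ≈D D' → KMove D r D'
  stuck : ∀ c → (r , c) ∈ D → (∀ c' → (r , c') ∈ D → c' ≤ c) →
          (∀ r' → 1 ≤ r' → r' < r → (r' , c) ∈ D) → D ≈D D' → KMove D r D'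
  -- rightmost cell (r , c) moves to (r' , c), r' the largest empty row below r
  moves : ∀ c r' → (r , c) ∈ D → (∀ c' → (r , c') ∈ D → c' ≤ c) →
          1 ≤ r' → r' < r → (r' , c) ∉ D →
          (∀ r'' → r' < r'' → r'' < r → (r'' , c) ∈ D) →
          (∀ x → ((x ∈ D' → ((x ∈ D × x ≢ (r , c)) ⊎ x ≡ (r' , c))) ×
                  (((x ∈ D × x ≢ (r , c)) ⊎ x ≡ (r' , c)) → x ∈ D'))) →
          KMove D r D'

KStep : Diagram → Diagram → Set
KStep D D' = Σ ℕ (λ r → KMove D r D')

Reach : Diagram → Diagram → Set
Reach = Star KStep

InKD : Diagram → Diagram → Set
InKD D₀ D = Reach D₀ D

_⪯_ : Diagram → Diagram → Set
D₂ ⪯ D₁ = Reach D₁ D₂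

blockers : Diagram → ℕ → ℕ → ℕ
blockers D c̃ r = length (filter (λ r̃ → (r̃ , c̃) ∈? D) (map suc (upTo r)))

-- max over c̃ ≥ c of |blockers_{D,c̃}(r,c)|; columns without cells contribute 0,
-- so it suffices to range over the columns occurring in D.
maxBlockers : Diagram → ℕ → ℕ → ℕ
maxBlockers D r c = foldr _⊔_ 0 (map (λ c̃ → blockers D c̃ r) (filter (c ≤?_) (map proj₂ D)))

-- room_D(r , c) = r − max_{c̃ ≥ c} |blockers_{D,c̃}(r , c)|  (never negative,
-- since each blocker count is ≤ r).
room : Diagram → ℕ → ℕ → ℕ
room D r c = r ∸ maxBlockers D r c

-- (r' , c) is the standard r-cell in column c of D relative to D₀
-- (where (r , c) ∈ D₀): it is the k-th lowest cell of column c in D,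
-- with k the position of (r , c) among the cells of column c in D₀.
StandardCell : Diagram → ℕ → ℕ → Diagram → ℕ → Set
StandardCell D₀ r c D r' = (r' , c) ∈ D × blockers D c r' ≡ blockers D₀ c r

{-# OPTIONS --safe #-}
module Submission where

-- A Kohnert move only lowers a cell within its column, so along a sequence of
-- moves the number of cells of any column lying in rows 1, …, t can only grow.
-- The standard r-cell of column c is the k-th lowest one for a fixed k, hence
-- it sits weakly lower in D₂ than in D₁: r₂ ≤ r₁. For every column c̃ ≥ c the
-- blockers of (r₁ , c) in D₁ are at most those of row r₁ in D₂, which exceed
-- the blockers of (r₂ , c) in D₂ by at most the r₁ − r₂ intermediate rows.
-- Taking maxima, the maximal blocker count drops by at most r₁ − r₂ from D₁
-- to D₂ while the row drops by exactly r₁ − r₂, so the room cannot grow.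

open import Defs
open import Data.Nat using (ℕ; zero; suc; _+_; _∸_; _≤_; _<_; _≤′_; ≤′-refl; ≤′-step; _⊔_; _≤?_; _≟_; z≤n; s≤s; z<s)
open import Data.Nat.Properties
open import Data.Product using (_×_; _,_; proj₁; proj₂)
open import Data.Product.Properties using (≡-dec)
open import Data.Sum using (inj₁; inj₂)
open import Data.List using ([_]; length; filter; map; foldr; upTo; _++_)
open import Data.List.Properties using (upTo-∷ʳ; map-++; filter-++; length-++; filter-none; foldr-forcesᵇ; foldr-preservesᵇ)
open import Data.List.Membership.Propositional using (_∈_; _∉_)
open import Data.List.Membership.Propositional.Properties using (∈-map⁺; ∈-map⁻; ∈-filter⁺; ∈-filter⁻)
open import Data.List.Membership.DecPropositional (≡-dec _≟_ _≟_) using (_∈?_)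
import Data.List.Membership.DecPropositional _≟_ as ℕ-Membership
open import Data.List.Relation.Unary.All as All using ()
open import Relation.Binary.PropositionalEquality using (_≡_; _≢_; refl; sym; cong; subst; module ≡-Reasoning)
open import Relation.Binary.Construct.Closure.ReflexiveTransitive using (ε; _◅_)
open import Relation.Nullary using (yes; no; contradiction)
open import Function using (_∘_)

indicator : Diagram → ℕ → ℕ → ℕ
indicator D c ρ with (ρ , c) ∈? D
... | yes _ = 1
... | no _ = 0

indicator-∈ : ∀ {D c ρ} → (ρ , c) ∈ D → indicator D c ρ ≡ 1
indicator-∈ {D} {c} {ρ} ρc∈D with (ρ , c) ∈? D
... | yes _ = refl
... | no ρc∉D = contradiction ρc∈D ρc∉D

indicator-∉ : ∀ {D c ρ} → (ρ , c) ∉ D → indicator D c ρ ≡ 0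
indicator-∉ {D} {c} {ρ} ρc∉D with (ρ , c) ∈? D
... | yes ρc∈D = contradiction ρc∈D ρc∉D
... | no _ = refl

indicator≤1 : ∀ D c ρ → indicator D c ρ ≤ 1
indicator≤1 D c ρ with (ρ , c) ∈? D
... | yes _ = ≤-refl
... | no _ = z≤n

indicator-mono : ∀ {D D' c ρ} → ((ρ , c) ∈ D → (ρ , c) ∈ D') → indicator D c ρ ≤ indicator D' c ρ
indicator-mono {D} {D'} {c} {ρ} D⊆D' with (ρ , c) ∈? D
... | yes ρc∈D = ≤-reflexive (sym (indicator-∈ (D⊆D' ρc∈D)))
... | no _ = z≤n

blockers-suc : ∀ D c t → blockers D c (suc t) ≡ blockers D c t + indicator D c (suc t)
blockers-suc D c t = begin
    length (filter P? (map suc (upTo (suc t))))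
      ≡⟨ cong (λ rows → length (filter P? (map suc rows))) (sym (upTo-∷ʳ t)) ⟩
    length (filter P? (map suc (upTo t ++ [ t ])))
      ≡⟨ cong (length ∘ filter P?) (map-++ suc (upTo t) [ t ]) ⟩
    length (filter P? (map suc (upTo t) ++ [ suc t ]))
      ≡⟨ cong length (filter-++ P? (map suc (upTo t)) [ suc t ]) ⟩
    length (filter P? (map suc (upTo t)) ++ filter P? [ suc t ])
      ≡⟨ length-++ (filter P? (map suc (upTo t))) ⟩
    blockers D c t + length (filter P? [ suc t ])
      ≡⟨ cong (blockers D c t +_) last-row ⟩
    blockers D c t + indicator D c (suc t) ∎
  where
  open ≡-Reasoning
  P? = λ r̃ → (r̃ , c) ∈? D
  last-row : length (filter P? [ suc t ]) ≡ indicator D c (suc t)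
  last-row with (suc t , c) ∈? D
  ... | yes _ = refl
  ... | no _ = refl

blockers-mono-⊆ : ∀ {D D' c} → (∀ ρ → (ρ , c) ∈ D → (ρ , c) ∈ D') →
                  ∀ t → blockers D c t ≤ blockers D' c t
blockers-mono-⊆ D⊆D' zero = z≤n
blockers-mono-⊆ {D} {D'} {c} D⊆D' (suc t)
  rewrite blockers-suc D c t | blockers-suc D' c t =
  +-mono-≤ (blockers-mono-⊆ D⊆D' t) (indicator-mono (D⊆D' (suc t)))

blockers-monoʳ : ∀ D c {s t} → s ≤ t → blockers D c s ≤ blockers D c t
blockers-monoʳ D c = mono′ ∘ ≤⇒≤′
  where
  mono′ : ∀ {s t} → s ≤′ t → blockers D c s ≤ blockers D c t
  mono′ ≤′-refl = ≤-refl
  mono′ {t = suc t} (≤′-step s≤′t) =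
    ≤-trans (mono′ s≤′t) (≤-trans (m≤m+n _ _) (≤-reflexive (sym (blockers-suc D c t))))

blockers-< : ∀ {D c s t} → (t , c) ∈ D → s < t → blockers D c s < blockers D c t
blockers-< {D} {c} {s} {suc t} tc∈D (s≤s s≤t) = begin-strict
    blockers D c s                          ≤⟨ blockers-monoʳ D c s≤t ⟩
    blockers D c t                          <⟨ m<m+n _ z<s ⟩
    blockers D c t + 1                      ≡⟨ cong (blockers D c t +_) (sym (indicator-∈ tc∈D)) ⟩
    blockers D c t + indicator D c (suc t)  ≡⟨ sym (blockers-suc D c t) ⟩
    blockers D c (suc t)                    ∎
  where open ≤-Reasoning

blockers[k+s]≤k+blockers[s] : ∀ D c k s → blockers D c (k + s) ≤ k + blockers D c s
blockers[k+s]≤k+blockers[s] D c zero s = ≤-refl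
blockers[k+s]≤k+blockers[s] D c (suc k) s = begin
    blockers D c (suc (k + s))                              ≡⟨ blockers-suc D c (k + s) ⟩
    blockers D c (k + s) + indicator D c (suc (k + s))      ≡⟨ +-comm (blockers D c (k + s)) _ ⟩
    indicator D c (suc (k + s)) + blockers D c (k + s)      ≤⟨ +-mono-≤ (indicator≤1 D c _) (blockers[k+s]≤k+blockers[s] D c k s) ⟩
    suc (k + blockers D c s)                                ∎
  where open ≤-Reasoning

column∉⇒blockers≡0 : ∀ {D c} → c ∉ map proj₂ D → ∀ t → blockers D c t ≡ 0
column∉⇒blockers≡0 {D} {c} c∉D t =
  cong length (filter-none (λ r̃ → (r̃ , c) ∈? D) (All.tabulate outside-column))
  where
  outside-column : ∀ {r̃} → r̃ ∈ map suc (upTo t) → (r̃ , c) ∉ D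
  outside-column _ r̃c∈D = c∉D (∈-map⁺ proj₂ r̃c∈D)

-- Between rows a' and a the count in D' is strictly larger, which pays for losing row a.
blockers-lowering : ∀ {D D' d a a'} → 1 ≤ a' → a' < a → (a' , d) ∉ D → (a' , d) ∈ D' →
                    (∀ ρ → ρ ≢ a → (ρ , d) ∈ D → (ρ , d) ∈ D') →
                    ∀ t → blockers D d t ≤ blockers D' d t
blockers-lowering {D} {D'} {d} {a} {a'} 1≤a' a'<a a'∉D a'∈D' kept t = proj₁ (invariant t)
  where
  invariant : ∀ t → blockers D d t ≤ blockers D' d t ×
                    (a' ≤ t → t < a → blockers D d t < blockers D' d t)
  invariant zero = z≤n , λ a'≤0 _ → contradiction (≤-trans 1≤a' a'≤0) λ ()
  invariant (suc t) rewrite blockers-suc D d t | blockers-suc D' d t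
    with invariant t | suc t ≟ a | suc t ≟ a'
  ... | _ , ih< | yes refl | _ = row-a , λ _ a<a → contradiction a<a (<-irrefl refl)
    where
    open ≤-Reasoning
    row-a : blockers D d t + indicator D d a ≤ blockers D' d t + indicator D' d a
    row-a = begin
      blockers D d t + indicator D d a   ≤⟨ +-monoʳ-≤ _ (indicator≤1 D d a) ⟩
      blockers D d t + 1                 ≡⟨ +-comm _ 1 ⟩
      suc (blockers D d t)               ≤⟨ ih< (≤-pred a'<a) (n<1+n t) ⟩
      blockers D' d t                    ≤⟨ m≤m+n _ _ ⟩
      blockers D' d t + indicator D' d a ∎
  ... | ih , _ | no _ | yes refl = <⇒≤ row-a' , λ _ _ → row-a'
    where
    open ≤-Reasoning
    row-a' : blockers D d t + indicator D d a' < blockers D' d t + indicator D' d a'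
    row-a' = begin-strict
      blockers D d t + indicator D d a'   ≡⟨ cong (blockers D d t +_) (indicator-∉ a'∉D) ⟩
      blockers D d t + 0                  <⟨ +-mono-≤-< ih z<s ⟩
      blockers D' d t + 1                 ≡⟨ cong (blockers D' d t +_) (sym (indicator-∈ a'∈D')) ⟩
      blockers D' d t + indicator D' d a' ∎
  ... | ih , ih< | no t+1≢a | no t+1≢a' =
    +-mono-≤ ih row-t+1 ,
    λ a'≤t+1 t+1<a → +-mono-<-≤ (ih< (≤-pred (≤∧≢⇒< a'≤t+1 (t+1≢a' ∘ sym))) (<⇒≤ t+1<a)) row-t+1
    where
    row-t+1 : indicator D d (suc t) ≤ indicator D' d (suc t)
    row-t+1 = indicator-mono (kept (suc t) t+1≢a)

_≤ᵇ_ : Diagram → Diagram → Set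
D ≤ᵇ D' = ∀ c t → blockers D c t ≤ blockers D' c t

≈D⇒≤ᵇ : ∀ {D D'} → D ≈D D' → D ≤ᵇ D'
≈D⇒≤ᵇ D≈D' c = blockers-mono-⊆ (λ ρ → proj₁ (D≈D' (ρ , c)))

kmove⇒≤ᵇ : ∀ {D D' ρ} → KMove D ρ D' → D ≤ᵇ D'
kmove⇒≤ᵇ (rowEmpty _ D≈D') = ≈D⇒≤ᵇ D≈D'
kmove⇒≤ᵇ (stuck _ _ _ _ D≈D') = ≈D⇒≤ᵇ D≈D'
kmove⇒≤ᵇ {D} {D'} {ρ} (moves d a' _ _ 1≤a' a'<a a'∉D _ D'≡moved) c with c ≟ d
... | yes refl = blockers-lowering 1≤a' a'<a a'∉D (∈D' (inj₂ refl))
                   (λ ρ' ρ'≢ρ ρ'∈D → ∈D' (inj₁ (ρ'∈D , ρ'≢ρ ∘ cong proj₁)))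
  where ∈D' = λ {x} → proj₂ (D'≡moved x)
... | no c≢d = blockers-mono-⊆ (λ ρ' ρ'∈D → proj₂ (D'≡moved _) (inj₁ (ρ'∈D , c≢d ∘ cong proj₂)))

reach⇒≤ᵇ : ∀ {D D'} → Reach D D' → D ≤ᵇ D'
reach⇒≤ᵇ ε c t = ≤-refl
reach⇒≤ᵇ ((_ , step) ◅ steps) c t = ≤-trans (kmove⇒≤ᵇ step c t) (reach⇒≤ᵇ steps c t)

standardCell-descends : ∀ {D₀ r c D₁ D₂ r₁ r₂} → D₁ ≤ᵇ D₂ →
                        StandardCell D₀ r c D₁ r₁ → StandardCell D₀ r c D₂ r₂ → r₂ ≤ r₁
standardCell-descends {D₀} {r} {c} {D₁} {D₂} {r₁} {r₂} D₁≤D₂ (_ , k₁) (r₂∈D₂ , k₂) =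
  ≮⇒≥ λ r₁<r₂ → <-irrefl refl (begin-strict
    blockers D₂ c r₁ <⟨ blockers-< r₂∈D₂ r₁<r₂ ⟩
    blockers D₂ c r₂ ≡⟨ k₂ ⟩
    blockers D₀ c r  ≡⟨ sym k₁ ⟩
    blockers D₁ c r₁ ≤⟨ D₁≤D₂ c r₁ ⟩
    blockers D₂ c r₁ ∎)
  where open ≤-Reasoning

≤-foldr-⊔ : ∀ {x xs} → x ∈ xs → x ≤ foldr _⊔_ 0 xs
≤-foldr-⊔ {xs = xs} = All.lookup (foldr-forcesᵇ {P = _≤ foldr _⊔_ 0 xs}
                                    (λ m n m⊔n≤ → m⊔n≤o⇒m≤o m n m⊔n≤ , m⊔n≤o⇒n≤o m n m⊔n≤) 0 xs ≤-refl)

blockers≤maxBlockers : ∀ D t {c c̃} → c ≤ c̃ → blockers D c̃ t ≤ maxBlockers D t c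
blockers≤maxBlockers D t {c} {c̃} c≤c̃ with c̃ ℕ-Membership.∈? map proj₂ D
... | yes c̃∈D = ≤-foldr-⊔ (∈-map⁺ (λ c' → blockers D c' t) (∈-filter⁺ (c ≤?_) c̃∈D c≤c̃))
... | no c̃∉D = subst (_≤ maxBlockers D t c) (sym (column∉⇒blockers≡0 c̃∉D t)) z≤n

maxBlockers-least : ∀ D t c {b} → (∀ c̃ → c ≤ c̃ → blockers D c̃ t ≤ b) → maxBlockers D t c ≤ b
maxBlockers-least D t c {b} bound = foldr-preservesᵇ {P = _≤ b} ⊔-lub z≤n (All.tabulate bounded)
  where
  bounded : ∀ {m} → m ∈ map (λ c̃ → blockers D c̃ t) (filter (c ≤?_) (map proj₂ D)) → m ≤ b
  bounded m∈ with ∈-map⁻ (λ c̃ → blockers D c̃ t) m∈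
  ... | c̃ , c̃∈ , refl = bound c̃ (proj₂ (∈-filter⁻ (c ≤?_) {xs = map proj₂ D} c̃∈))

maxBlockers-descent : ∀ {D₁ D₂ r₁ r₂} c → D₁ ≤ᵇ D₂ → r₂ ≤ r₁ →
                      maxBlockers D₁ r₁ c ≤ (r₁ ∸ r₂) + maxBlockers D₂ r₂ c
maxBlockers-descent {D₁} {D₂} {r₁} {r₂} c D₁≤D₂ r₂≤r₁ = maxBlockers-least D₁ r₁ c λ c̃ c≤c̃ → begin
    blockers D₁ c̃ r₁                 ≤⟨ D₁≤D₂ c̃ r₁ ⟩
    blockers D₂ c̃ r₁                 ≡⟨ cong (blockers D₂ c̃) (sym (m∸n+n≡m r₂≤r₁)) ⟩
    blockers D₂ c̃ ((r₁ ∸ r₂) + r₂)   ≤⟨ blockers[k+s]≤k+blockers[s] D₂ c̃ (r₁ ∸ r₂) r₂ ⟩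
    (r₁ ∸ r₂) + blockers D₂ c̃ r₂     ≤⟨ +-monoʳ-≤ (r₁ ∸ r₂) (blockers≤maxBlockers D₂ r₂ c≤c̃) ⟩
    (r₁ ∸ r₂) + maxBlockers D₂ r₂ c  ∎
  where open ≤-Reasoning

n∸q≤m∸p : ∀ {m n p q} → n ≤ m → p ≤ (m ∸ n) + q → n ∸ q ≤ m ∸ p
n∸q≤m∸p {m} {n} {p} {q} n≤m p≤ = begin
    n ∸ q                          ≡⟨ sym ([m+n]∸[m+o]≡n∸o (m ∸ n) n q) ⟩
    ((m ∸ n) + n) ∸ ((m ∸ n) + q)  ≡⟨ cong (_∸ ((m ∸ n) + q)) (m∸n+n≡m n≤m) ⟩
    m ∸ ((m ∸ n) + q)              ≤⟨ ∸-monoʳ-≤ m p≤ ⟩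
    m ∸ p                          ∎
  where open ≤-Reasoning

lemma3p2 : (D₀ : Diagram) → WellFormed D₀ → (r c : ℕ) → (r , c) ∈ D₀ →
           (D₁ D₂ : Diagram) → InKD D₀ D₁ → InKD D₀ D₂ → D₂ ⪯ D₁ →
           (r₁ r₂ : ℕ) → StandardCell D₀ r c D₁ r₁ → StandardCell D₀ r c D₂ r₂ →
           room D₂ r₂ c ≤ room D₁ r₁ c
lemma3p2 D₀ _ r c _ D₁ D₂ _ _ D₂⪯D₁ r₁ r₂ std₁ std₂ =
  n∸q≤m∸p r₂≤r₁ (maxBlockers-descent c D₁≤D₂ r₂≤r₁)
  where
  D₁≤D₂ : D₁ ≤ᵇ D₂
  D₁≤D₂ = reach⇒≤ᵇ D₂⪯D₁
  r₂≤r₁ : r₂ ≤ r₁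
  r₂≤r₁ = standardCell-descends {D₀} {r} {c} D₁≤D₂ std₁ std₂
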